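{- Let $\mathcal{I}^A,\mathcal{I}^B$ be instances on the same graph $G=(W\cup F,E)$ that differ only in the preference order of agent $x$, let $e=\{x,y\}\in E$, and let $\mathcal{I}^H$ be the hybrid instance with respect to $e$. (1) There exists a robust popular matching with respect to $\mathcal{I}^A,\mathcal{I}^B$ containing $e$ if and only if $\mathcal{I}^H$ has a popular matching containing $e$. (2) There exists a robust dominant matching with respect to $\mathcal{I}^A,\mathcal{I}^B$ containing $e$ if and only if $\mathcal{I}^H$ has a dominant matching containing $e$.
   Context: An instance $\mathcal{I}$ of matchings under preferences consists of a finite bipartite graph $(W\cup F,E)$ and, for every agent $z$, a strict linear order $\succ_z^{\mathcal{I}}$ over its neighbour set $N_z$. A matching is a set of pairwise disjoint edges; $M(z)$ is the partner of matched $z$. Agent $z$ prefers $M$ over $M'$ if $z$ is matched in $M$ and unmatched in $M'$, or matched in both and $M(z)\succ_z M'(z)$; $\mathrm{vote}_z(M,M')$ is $1$, $-1$, $0$ accordingly, and $\Delta^{\mathcal{I}}(M,M')=\sum_z\mathrm{vote}_z(M,M')$. $M$ is popular if $\Delta^{\mathcal{I}}(M,M')\ge 0$ for all matchings $M'$, dominant if popular and $\Delta^{\mathcal{I}}(M,M')>0$ for all $M'$ with $|M'|>|M|$; robust popular/dominant means popular/dominant in both $\mathcal{I}^A$ and $\mathcal{I}^B$. Hybrid instance: let $P^A=\{z: z\succ_x^A y\}$, $P^B=\{z: z\succ_x^B y\}$, and let $\succ'$ be any linear order on $N_x$ with $z\succ' y$ for all $z\in P^A\cup P^B$ and $y\succ'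 z$ for all $z\in N_x\setminus(P^A\cup P^B\cup\{y\})$. $\mathcal{I}^H$ is the instance on $G$ where every agent $z\ne x$ has order $\succ_z^A$ and $x$ has order $\succ'$. -}

module Defs where

open import Data.Bool using (Bool; true; false; T; if_then_else_)
open import Data.Nat using (ℕ; zero; suc; _<_; _<ᵇ_)
open import Data.Integer using (ℤ; _≤_; _<_; 0ℤ; 1ℤ; -1ℤ) renaming (_+_ to _+ℤ_)
open import Data.Fin using (Fin; zero; suc)
import Data.Fin.Properties as FinP
open import Data.Sum using (_⊎_; inj₁; inj₂)
import Data.Sum.Properties as SumP
open import Data.Maybe using (Maybe; just; nothing)
open import Data.List using (List; []; _∷_; _++_; map; foldr; allFin)
open import Data.List.Membership.Propositional using (_∈_)
open import Data.List.Relation.Unary.Unique.Propositional using (Unique)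
open import Data.Product using (_×_; Σ; ∃; ∃-syntax)
open import Relation.Nullary using (¬_; yes; no)
open import Relation.Binary.PropositionalEquality using (_≡_)
open import Relation.Binary using (DecidableEquality)
open import Function.Bundles using (_⇔_)

Agent : ℕ → ℕ → Set
Agent nW nF = Fin nW ⊎ Fin nF

_≟A_ : ∀ {nW nF} → DecidableEquality (Agent nW nF)
_≟A_ = SumP.≡-dec FinP._≟_ FinP._≟_

Graph : ℕ → ℕ → Set
Graph nW nF = Fin nW → Fin nF → Bool

Adj : ∀ {nW nF} → Graph nW nF → Agent nW nF → Agent nW nF → Bool
Adj G (inj₁ w) (inj₂ f) = G w f
Adj G (inj₂ f) (inj₁ w) = G w f
Adj G (inj₁ _) (inj₁ _) = false
Adj G (inj₂ _) (inj₂ _) = false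

-- Preferences: for every agent z a list of agents, best first.
Prefs : ℕ → ℕ → Set
Prefs nW nF = Agent nW nF → List (Agent nW nF)

-- A strict linear order over the neighbour set N_z, encoded as a
-- duplicate-free list whose elements are exactly the neighbours of z.
ValidPrefs : ∀ {nW nF} → Graph nW nF → Prefs nW nF → Set
ValidPrefs G P = ∀ z → Unique (P z) × (∀ a → (a ∈ P z) ⇔ T (Adj G z a))

-- Position of an agent in a list (length of the list if absent).
rank : ∀ {nW nF} → List (Agent nW nF) → Agent nW nF → ℕ
rank [] a = 0
rank (b ∷ l) a with a ≟A b
... | yes _ = 0
... | no _ = suc (rank l a)

Prefers : ∀ {nW nF} → Prefs nW nF → Agent nW nF → Agent nW nF → Agent nW nF → Set
Prefers P z a b = a ∈ P z × b ∈ P z × rank (P z) a Data.Nat.< rank (P z) b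

EdgeSet : ℕ → ℕ → Set
EdgeSet nW nF = Fin nW → Fin nF → Bool

IsMatching : ∀ {nW nF} → Graph nW nF → EdgeSet nW nF → Set
IsMatching G M =
  (∀ w f → T (M w f) → T (G w f)) ×
  (∀ w f f′ → T (M w f) → T (M w f′) → f ≡ f′) ×
  (∀ w w′ f → T (M w f) → T (M w′ f) → w ≡ w′)

InM : ∀ {nW nF} → EdgeSet nW nF → Agent nW nF → Agent nW nF → Bool
InM M a b = Adj M a b

firstTrue : ∀ {n} → (Fin n → Bool) → Maybe (Fin n)
firstTrue {zero} p = nothing
firstTrue {suc n} p with p zero
... | true = just zero
... | false = Data.Maybe.map suc (firstTrue (λ i → p (suc i)))

partner : ∀ {nW nF} → EdgeSet nW nF → Agent nW nF → Maybe (Agent nW nF)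
partner M (inj₁ w) = Data.Maybe.map inj₂ (firstTrue (λ f → M w f))
partner M (inj₂ f) = Data.Maybe.map inj₁ (firstTrue (λ w → M w f))

vote : ∀ {nW nF} → Prefs nW nF → EdgeSet nW nF → EdgeSet nW nF → Agent nW nF → ℤ
vote P M M′ z with partner M z | partner M′ z
... | nothing | nothing = 0ℤ
... | just _  | nothing = 1ℤ
... | nothing | just _  = -1ℤ
... | just a  | just b  =
  if rank (P z) a <ᵇ rank (P z) b then 1ℤ
  else if rank (P z) b <ᵇ rank (P z) a then -1ℤ
  else 0ℤ

allAgents : (nW nF : ℕ) → List (Agent nW nF)
allAgents nW nF = map inj₁ (allFin nW) ++ map inj₂ (allFin nF)

sumℤ : List ℤ → ℤ
sumℤ = foldr _+ℤ_ 0ℤ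

Δ : ∀ {nW nF} → Prefs nW nF → EdgeSet nW nF → EdgeSet nW nF → ℤ
Δ {nW} {nF} P M M′ = sumℤ (map (vote P M M′) (allAgents nW nF))

count : ∀ {n} → (Fin n → ℕ) → ℕ
count {zero} g = 0
count {suc n} g = g zero Data.Nat.+ count (λ i → g (suc i))

size : ∀ {nW nF} → EdgeSet nW nF → ℕ
size M = count (λ w → count (λ f → if M w f then 1 else 0))

Popular : ∀ {nW nF} → Graph nW nF → Prefs nW nF → EdgeSet nW nF → Set
Popular G P M =
  IsMatching G M × (∀ M′ → IsMatching G M′ → 0ℤ ≤ Δ P M M′)

Dominant : ∀ {nW nF} → Graph nW nF → Prefs nW nF → EdgeSet nW nF → Set
Dominant G P M =
  Popular G P M ×
  (∀ M′ → IsMatching G M′ → size M Data.Nat.< size M′ → 0ℤ Data.Integer.< Δ P M M′)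

DifferOnlyAt : ∀ {nW nF} → Prefs nW nF → Prefs nW nF → Agent nW nF → Set
DifferOnlyAt PA PB x = ∀ z → ¬ z ≡ x → PA z ≡ PB z

IsHybrid : ∀ {nW nF} → Graph nW nF → Prefs nW nF → Prefs nW nF →
           Agent nW nF → Agent nW nF → Prefs nW nF → Set
IsHybrid G PA PB x y PH =
  ValidPrefs G PH ×
  (∀ z → ¬ z ≡ x → PH z ≡ PA z) ×
  (∀ z → (Prefers PA x z y ⊎ Prefers PB x z y) → Prefers PH x z y) ×
  (∀ z → T (Adj G x z) → ¬ Prefers PA x z y → ¬ Prefers PB x z y → ¬ z ≡ y →
     Prefers PH x y z)

{-# OPTIONS --safe #-}

-- If M contains e = {x, y}, then in every comparison with another matching M′ the vote of x in the
-- hybrid instance is the minimum of its votes in I^A and I^B: x sits with y in M, and ≻′ ranks above y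
-- exactly the neighbours that x ranks above y in I^A or in I^B. All other agents vote alike in the three
-- instances, so the A- and B-votes are pointwise comparable and hence
-- Δ^H(M, M′) = min (Δ^A(M, M′), Δ^B(M, M′)). Popularity and dominance ask Δ(M, M′) to lie in an
-- upward-closed set, and min (a, b) lies there iff both a and b do.
module Submission where

open import Defs
open import Data.Nat using (ℕ)
open import Data.Bool using (Bool; true; false; T; if_then_else_)
open import Data.Product using (_×_; ∃-syntax; _,_; proj₁; proj₂)
open import Function.Bundles using (_⇔_; mk⇔; Equivalence)
open import Data.Bool.Properties using (T-≡)
open import Data.Empty using (⊥-elim)
open import Data.Fin using (Fin; zero; suc)
open import Data.Integer using (ℤ; 0ℤ; 1ℤ; -1ℤ; _≤_; _<_; _⊓_; -≤+)
import Data.Integer.Properties as ℤ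
open import Data.List using (List; []; _∷_; map)
open import Data.List.Membership.Propositional using (_∈_)
open import Data.List.Relation.Unary.Any using (here; there)
open import Data.List.Properties using (map-cong)
open import Data.Maybe using (Maybe; just; nothing)
import Data.Nat as ℕ
import Data.Nat.Properties as ℕ
open import Data.Sum using (_⊎_; inj₁; inj₂)
import Data.Sum as Sum
open import Function using (_∘_)
open import Relation.Binary using (DecidableEquality; _Respects_; tri<; tri≈; tri>)
open import Relation.Binary.PropositionalEquality
open import Relation.Nullary using (¬_; yes; no)
open ≡-Reasoning

private
  variable
    A : Set
    nW nF : ℕ

⊓-⇔ : (P : ℤ → Set) → P Respects _≤_ → ∀ i j → P (i ⊓ j) ⇔ (P i × P j)
⊓-⇔ P mono i j = mk⇔ (λ p → mono (ℤ.i⊓j≤i i j) p , mono (ℤ.i⊓j≤j i j) p) both⇒⊓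
  where
  both⇒⊓ : P i × P j → P (i ⊓ j)
  both⇒⊓ (pi , pj) with ℤ.⊓-sel i j
  ... | inj₁ i⊓j≡i = subst P (sym i⊓j≡i) pi
  ... | inj₂ i⊓j≡j = subst P (sym i⊓j≡j) pj

sumℤ-mono : (l : List A) {f g : A → ℤ} → (∀ z → f z ≤ g z) → sumℤ (map f l) ≤ sumℤ (map g l)
sumℤ-mono []      f≤g = ℤ.≤-refl
sumℤ-mono (a ∷ l) f≤g = ℤ.+-mono-≤ (f≤g a) (sumℤ-mono l f≤g)

sumℤ-⊓ : (l : List A) {f g : A → ℤ} → (∀ z → f z ≤ g z) →
         sumℤ (map (λ z → f z ⊓ g z) l) ≡ sumℤ (map f l) ⊓ sumℤ (map g l)
sumℤ-⊓ l {f} {g} f≤g = begin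
  sumℤ (map (λ z → f z ⊓ g z) l)  ≡⟨ cong sumℤ (map-cong (λ z → ℤ.i≤j⇒i⊓j≡i (f≤g z)) l) ⟩
  sumℤ (map f l)                  ≡˘⟨ ℤ.i≤j⇒i⊓j≡i (sumℤ-mono l f≤g) ⟩
  sumℤ (map f l) ⊓ sumℤ (map g l) ∎

sumℤ-⊓-comparable : (l : List A) {f g : A → ℤ} → (∀ z → f z ≤ g z) ⊎ (∀ z → g z ≤ f z) →
                    sumℤ (map (λ z → f z ⊓ g z) l) ≡ sumℤ (map f l) ⊓ sumℤ (map g l)
sumℤ-⊓-comparable l (inj₁ f≤g) = sumℤ-⊓ l f≤g
sumℤ-⊓-comparable l {f} {g} (inj₂ g≤f) = begin
  sumℤ (map (λ z → f z ⊓ g z) l)  ≡⟨ cong sumℤ (map-cong (λ z → ℤ.⊓-comm (f z) (g z)) l) ⟩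
  sumℤ (map (λ z → g z ⊓ f z) l)  ≡⟨ sumℤ-⊓ l g≤f ⟩
  sumℤ (map g l) ⊓ sumℤ (map f l) ≡⟨ ℤ.⊓-comm _ _ ⟩
  sumℤ (map f l) ⊓ sumℤ (map g l) ∎

≤-total-pointwise : DecidableEquality A → (x : A) {f g : A → ℤ} → (∀ z → ¬ z ≡ x → f z ≡ g z) →
                    (∀ z → f z ≤ g z) ⊎ (∀ z → g z ≤ f z)
≤-total-pointwise _≟_ x {f} {g} agree =
  Sum.map (extend agree) (extend (λ z z≢x → sym (agree z z≢x))) (ℤ.≤-total (f x) (g x))
  where
  extend : {h k : _ → ℤ} → (∀ z → ¬ z ≡ x → h z ≡ k z) → h x ≤ k x → ∀ z → h z ≤ k z
  extend h≗k hx≤kx z with z ≟ x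
  ... | yes refl = hx≤kx
  ... | no z≢x   = ℤ.≤-reflexive (h≗k z z≢x)

firstTrue-sound : ∀ {n} (p : Fin n → Bool) {i} → firstTrue p ≡ just i → T (p i)
firstTrue-sound {ℕ.suc n} p eq with p zero in p0
firstTrue-sound {ℕ.suc n} p refl | true = Equivalence.from T-≡ p0
... | false with firstTrue (p ∘ suc) in eq′
... | just j with refl ← eq = firstTrue-sound (p ∘ suc) eq′

firstTrue-complete : ∀ {n} (p : Fin n → Bool) {i} → firstTrue p ≡ nothing → ¬ T (p i)
firstTrue-complete {ℕ.suc n} p eq pi with p zero in p0
firstTrue-complete {ℕ.suc n} p () pi | true
firstTrue-complete {ℕ.suc n} p {zero} eq pi | false rewrite p0 = pi
firstTrue-complete {ℕ.suc n} p {suc i} eq pi | false with firstTrue (p ∘ suc) in eq′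
... | nothing = firstTrue-complete (p ∘ suc) eq′ pi

partner⇒InM : (M : EdgeSet nW nF) (z : Agent nW nF) {b : Agent nW nF} → partner M z ≡ just b → T (InM M z b)
partner⇒InM M (inj₁ w) eq with firstTrue (M w) in found
partner⇒InM M (inj₁ w) refl | just f = firstTrue-sound (M w) found
partner⇒InM M (inj₂ f) eq with firstTrue (λ w → M w f) in found
partner⇒InM M (inj₂ f) refl | just w = firstTrue-sound (λ w → M w f) found

InM⇒Adj : {G : Graph nW nF} {M : EdgeSet nW nF} → IsMatching G M →
          (z b : Agent nW nF) → T (InM M z b) → T (Adj G z b)
InM⇒Adj (M⊆G , _) (inj₁ w) (inj₂ f) = M⊆G w f
InM⇒Adj (M⊆G , _) (inj₂ f) (inj₁ w) = M⊆G w f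

InM⇒partner : {G : Graph nW nF} {M : EdgeSet nW nF} → IsMatching G M →
              (z b : Agent nW nF) → T (InM M z b) → partner M z ≡ just b
InM⇒partner {M = M} (_ , workerUnique , _) (inj₁ w) (inj₂ f) wf with firstTrue (M w) in found
... | just f′  = cong (just ∘ inj₂) (workerUnique w f′ f (firstTrue-sound (M w) found) wf)
... | nothing = ⊥-elim (firstTrue-complete (M w) found wf)
InM⇒partner {M = M} (_ , _ , firmUnique) (inj₂ f) (inj₁ w) wf with firstTrue (λ w → M w f) in found
... | just w′  = cong (just ∘ inj₁) (firmUnique w′ w f (firstTrue-sound (λ w → M w f) found) wf)
... | nothing = ⊥-elim (firstTrue-complete (λ w → M w f) found wf)

partner⇒Adj : {G : Graph nW nF} {M : EdgeSet nW nF} → IsMatching G M →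
              (z : Agent nW nF) {b : Agent nW nF} → partner M z ≡ just b → T (Adj G z b)
partner⇒Adj {M = M} isM z {b} eq = InM⇒Adj isM z b (partner⇒InM M z eq)

<ᵇ≡true : ∀ {m n} → m ℕ.< n → (m ℕ.<ᵇ n) ≡ true
<ᵇ≡true = Equivalence.to T-≡ ∘ ℕ.<⇒<ᵇ

<ᵇ≡false : ∀ {m n} → ¬ m ℕ.< n → (m ℕ.<ᵇ n) ≡ false
<ᵇ≡false {m} {n} m≮n with m ℕ.<ᵇ n in eq
... | true  = ⊥-elim (m≮n (ℕ.<ᵇ⇒< m n (Equivalence.from T-≡ eq)))
... | false = refl

rankVote : ℕ → ℕ → ℤ
rankVote m n = if m ℕ.<ᵇ n then 1ℤ else if n ℕ.<ᵇ m then -1ℤ else 0ℤ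

rankVote-< : ∀ {m n} → m ℕ.< n → rankVote m n ≡ 1ℤ
rankVote-< m<n rewrite <ᵇ≡true m<n = refl

rankVote-> : ∀ {m n} → n ℕ.< m → rankVote m n ≡ -1ℤ
rankVote-> n<m rewrite <ᵇ≡false (ℕ.<⇒≯ n<m) | <ᵇ≡true n<m = refl

rankVote-refl : ∀ n → rankVote n n ≡ 0ℤ
rankVote-refl n rewrite <ᵇ≡false (ℕ.<-irrefl {n} refl) = refl

-1≤rankVote : ∀ m n → -1ℤ ≤ rankVote m n
-1≤rankVote m n with m ℕ.<ᵇ n | n ℕ.<ᵇ m
... | true  | _     = -≤+
... | false | true  = ℤ.≤-refl
... | false | false = -≤+

voteMatchedTo : List (Agent nW nF) → Agent nW nF → Maybe (Agent nW nF) → ℤ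
voteMatchedTo l a nothing  = 1ℤ
voteMatchedTo l a (just b) = rankVote (rank l a) (rank l b)

vote-matched : (P : Prefs nW nF) (M M′ : EdgeSet nW nF) (z : Agent nW nF) {a : Agent nW nF} →
               partner M z ≡ just a → vote P M M′ z ≡ voteMatchedTo (P z) a (partner M′ z)
vote-matched P M M′ z eq with partner M z | partner M′ z
vote-matched P M M′ z refl | just a | nothing = refl
vote-matched P M M′ z refl | just a | just b  = refl

vote-cong : {P Q : Prefs nW nF} (M M′ : EdgeSet nW nF) (z : Agent nW nF) →
            P z ≡ Q z → vote P M M′ z ≡ vote Q M M′ z
vote-cong M M′ z eq with partner M z | partner M′ z
... | nothing | nothing = refl
... | just _  | nothing = refl
... | nothing | just _  = refl
... | just a  | just b  rewrite eq = refl

rank-injective : (l : List (Agent nW nF)) {a b : Agent nW nF} → a ∈ l → b ∈ l → rank l a ≡ rank l b → a ≡ b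
rank-injective (c ∷ l) {a} {b} a∈ b∈ eq with a ≟A c | b ≟A c
... | yes refl | yes refl = refl
... | yes _    | no _     = ⊥-elim (ℕ.0≢1+n eq)
... | no _     | yes _    = ⊥-elim (ℕ.0≢1+n (sym eq))
rank-injective (c ∷ l) (here a≡c)  _           eq | no a≢c | no _   = ⊥-elim (a≢c a≡c)
rank-injective (c ∷ l) (there _)   (here b≡c)  eq | no _   | no b≢c = ⊥-elim (b≢c b≡c)
rank-injective (c ∷ l) (there a∈) (there b∈) eq | no _   | no _   = rank-injective l a∈ b∈ (ℕ.suc-injective eq)

module _ (P : Prefs nW nF) (z : Agent nW nF) where

  Prefers-irrefl : ∀ {a b} → Prefers P z a b → ¬ a ≡ b
  Prefers-irrefl (_ , _ , a<b) refl = ℕ.<-irrefl refl a<b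

  Prefers-asym : ∀ {a b} → Prefers P z a b → ¬ Prefers P z b a
  Prefers-asym (_ , _ , a<b) (_ , _ , b<a) = ℕ.<-asym a<b b<a

  Prefers-trichotomy : ∀ {a b} → a ∈ P z → b ∈ P z → Prefers P z a b ⊎ a ≡ b ⊎ Prefers P z b a
  Prefers-trichotomy {a} {b} a∈ b∈ with ℕ.<-cmp (rank (P z) a) (rank (P z) b)
  ... | tri< a<b _ _ = inj₁ (a∈ , b∈ , a<b)
  ... | tri≈ _ a≈b _ = inj₂ (inj₁ (rank-injective (P z) a∈ b∈ a≈b))
  ... | tri> _ _ b<a = inj₂ (inj₂ (b∈ , a∈ , b<a))

Adj⇒∈ : {G : Graph nW nF} {P : Prefs nW nF} → ValidPrefs G P → ∀ {z a} → T (Adj G z a) → a ∈ P z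
Adj⇒∈ valid {z} {a} = Equivalence.from (proj₂ (valid z) a)

Unbeaten : Graph nW nF → Prefs nW nF → EdgeSet nW nF → Set
Unbeaten G P M = ∀ M′ → IsMatching G M′ → 0ℤ ≤ Δ P M M′

BeatsLarger : Graph nW nF → Prefs nW nF → EdgeSet nW nF → Set
BeatsLarger G P M = ∀ M′ → IsMatching G M′ → size M ℕ.< size M′ → 0ℤ < Δ P M M′

module Hybrid
  (G : Graph nW nF) (PA PB PH : Prefs nW nF) (x y : Agent nW nF)
  (validA : ValidPrefs G PA) (validB : ValidPrefs G PB) (differ : DifferOnlyAt PA PB x)
  (xy : T (Adj G x y))
  (keep : ∀ z → ¬ z ≡ x → PH z ≡ PA z)
  (raise : ∀ z → (Prefers PA x z y ⊎ Prefers PB x z y) → Prefers PH x z y)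
  (lower : ∀ z → T (Adj G x z) → ¬ Prefers PA x z y → ¬ Prefers PB x z y → ¬ z ≡ y → Prefers PH x y z)
  where

  xVote : Prefs nW nF → Agent nW nF → ℤ
  xVote P b = voteMatchedTo (P x) y (just b)

  xVote≡-1 : ∀ P {b} → Prefers P x b y → xVote P b ≡ -1ℤ
  xVote≡-1 _ (_ , _ , b<y) = rankVote-> b<y

  xVote≡1 : ∀ P {b} → Prefers P x y b → xVote P b ≡ 1ℤ
  xVote≡1 _ (_ , _ , y<b) = rankVote-< y<b

  -1≤xVote : ∀ P b → -1ℤ ≤ xVote P b
  -1≤xVote P b = -1≤rankVote (rank (P x) y) (rank (P x) b)

  xVote-hybrid : ∀ {b} → T (Adj G x b) → xVote PH b ≡ xVote PA b ⊓ xVote PB b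
  xVote-hybrid {b} xb with Prefers-trichotomy PA x (Adj⇒∈ validA xb) (Adj⇒∈ validA xy)
                         | Prefers-trichotomy PB x (Adj⇒∈ validB xb) (Adj⇒∈ validB xy)
  ... | inj₁ b≻y | _
    rewrite xVote≡-1 PH (raise b (inj₁ b≻y)) | xVote≡-1 PA b≻y = sym (ℤ.i≤j⇒i⊓j≡i (-1≤xVote PB b))
  ... | _ | inj₁ b≻y
    rewrite xVote≡-1 PH (raise b (inj₂ b≻y)) | xVote≡-1 PB b≻y = sym (ℤ.i≥j⇒i⊓j≡j (-1≤xVote PA b))
  ... | inj₂ (inj₁ refl) | _
    rewrite rankVote-refl (rank (PH x) b) | rankVote-refl (rank (PA x) b) | rankVote-refl (rank (PB x) b) = refl
  ... | inj₂ (inj₂ y≻Ab) | inj₂ (inj₁ refl) = ⊥-elim (Prefers-irrefl PA x y≻Ab refl)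
  ... | inj₂ (inj₂ y≻Ab) | inj₂ (inj₂ y≻Bb)
    rewrite xVote≡1 PH (lower b xb (Prefers-asym PA x y≻Ab) (Prefers-asym PB x y≻Bb)
                              (Prefers-irrefl PA x y≻Ab ∘ sym))
          | xVote≡1 PA y≻Ab | xVote≡1 PB y≻Bb = refl

  module _ {M : EdgeSet nW nF} (isM : IsMatching G M) (xy∈M : T (InM M x y)) where

    vote-hybrid : ∀ {M′} → IsMatching G M′ → ∀ z → vote PH M M′ z ≡ vote PA M M′ z ⊓ vote PB M M′ z
    vote-hybrid {M′} isM′ z with z ≟A x
    ... | yes refl = begin
      vote PH M M′ z                                ≡⟨ vote-matched PH M M′ z M[x]≡y ⟩
      voteMatchedTo (PH z) y (partner M′ z)         ≡⟨ x-vote (partner M′ z) refl ⟩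
      voteMatchedTo (PA z) y (partner M′ z) ⊓ voteMatchedTo (PB z) y (partner M′ z)
        ≡˘⟨ cong₂ _⊓_ (vote-matched PA M M′ z M[x]≡y) (vote-matched PB M M′ z M[x]≡y) ⟩
      vote PA M M′ z ⊓ vote PB M M′ z               ∎
      where
      M[x]≡y : partner M x ≡ just y
      M[x]≡y = InM⇒partner isM x y xy∈M
      x-vote : ∀ mb → partner M′ x ≡ mb →
               voteMatchedTo (PH x) y mb ≡ voteMatchedTo (PA x) y mb ⊓ voteMatchedTo (PB x) y mb
      x-vote nothing  _  = refl
      x-vote (just b) eq = xVote-hybrid (partner⇒Adj isM′ x eq)
    ... | no z≢x = begin
      vote PH M M′ z                  ≡⟨ vote-cong M M′ z (keep z z≢x) ⟩
      vote PA M M′ z                  ≡˘⟨ ℤ.⊓-idem _ ⟩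
      vote PA M M′ z ⊓ vote PA M M′ z ≡⟨ cong (vote PA M M′ z ⊓_) (vote-cong M M′ z (differ z z≢x)) ⟩
      vote PA M M′ z ⊓ vote PB M M′ z ∎

    Δ-hybrid : ∀ {M′} → IsMatching G M′ → Δ PH M M′ ≡ Δ PA M M′ ⊓ Δ PB M M′
    Δ-hybrid {M′} isM′ = begin
      sumℤ (map (vote PH M M′) agents)
        ≡⟨ cong sumℤ (map-cong (vote-hybrid isM′) agents) ⟩
      sumℤ (map (λ z → vote PA M M′ z ⊓ vote PB M M′ z) agents)
        ≡⟨ sumℤ-⊓-comparable agents (≤-total-pointwise _≟A_ x (λ z z≢x → vote-cong M M′ z (differ z z≢x))) ⟩
      Δ PA M M′ ⊓ Δ PB M M′ ∎
      where
      agents : List (Agent nW nF)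
      agents = allAgents nW nF

    Δ-hybrid-⇔ : (P : ℤ → Set) → P Respects _≤_ → ∀ {M′} → IsMatching G M′ →
                 P (Δ PH M M′) ⇔ (P (Δ PA M M′) × P (Δ PB M M′))
    Δ-hybrid-⇔ P mono isM′ = subst (λ d → P d ⇔ _) (sym (Δ-hybrid isM′)) (⊓-⇔ P mono _ _)

    Δ-hybrid-∀ : (P : EdgeSet nW nF → ℤ → Set) → (∀ M′ → P M′ Respects _≤_) →
                 (∀ M′ → IsMatching G M′ → P M′ (Δ PH M M′)) ⇔
                 ((∀ M′ → IsMatching G M′ → P M′ (Δ PA M M′)) × (∀ M′ → IsMatching G M′ → P M′ (Δ PB M M′)))
    Δ-hybrid-∀ P mono = mk⇔
      (λ h → (λ M′ isM′ → proj₁ (Equivalence.to (Δ-hybrid-⇔ (P M′) (mono M′) isM′) (h M′ isM′)))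
           , (λ M′ isM′ → proj₂ (Equivalence.to (Δ-hybrid-⇔ (P M′) (mono M′) isM′) (h M′ isM′))))
      (λ (hA , hB) M′ isM′ → Equivalence.from (Δ-hybrid-⇔ (P M′) (mono M′) isM′) (hA M′ isM′ , hB M′ isM′))

    unbeaten-hybrid : Unbeaten G PH M ⇔ (Unbeaten G PA M × Unbeaten G PB M)
    unbeaten-hybrid = Δ-hybrid-∀ (λ _ → 0ℤ ≤_) (λ _ i≤j 0≤i → ℤ.≤-trans 0≤i i≤j)

    beatsLarger-hybrid : BeatsLarger G PH M ⇔ (BeatsLarger G PA M × BeatsLarger G PB M)
    beatsLarger-hybrid =
      Δ-hybrid-∀ (λ M′ d → size M ℕ.< size M′ → 0ℤ < d) (λ _ i≤j 0<i larger → ℤ.<-≤-trans (0<i larger) i≤j)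

    popular-hybrid : Popular G PH M ⇔ (Popular G PA M × Popular G PB M)
    popular-hybrid = mk⇔
      (λ (_ , unbeaten) → let (unbeatenA , unbeatenB) = Equivalence.to unbeaten-hybrid unbeaten
                          in (isM , unbeatenA) , (isM , unbeatenB))
      (λ ((_ , unbeatenA) , (_ , unbeatenB)) → isM , Equivalence.from unbeaten-hybrid (unbeatenA , unbeatenB))

    dominant-hybrid : Dominant G PH M ⇔ (Dominant G PA M × Dominant G PB M)
    dominant-hybrid = mk⇔
      (λ (popH , winsH) → let (popA , popB) = Equivalence.to popular-hybrid popH
                              (winsA , winsB) = Equivalence.to beatsLarger-hybrid winsH
                          in (popA , winsA) , (popB , winsB))
      (λ ((popA , winsA) , (popB , winsB)) →
         Equivalence.from popular-hybrid (popA , popB) , Equivalence.from beatsLarger-hybrid (winsA , winsB))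

corollary1 : ∀ {nW nF} (G : Graph nW nF) (PA PB PH : Prefs nW nF)
    (x y : Agent nW nF) →
    ValidPrefs G PA → ValidPrefs G PB → DifferOnlyAt PA PB x →
    T (Adj G x y) → IsHybrid G PA PB x y PH →
    ((∃[ M ] (Popular G PA M × Popular G PB M × T (InM M x y)))
       ⇔ (∃[ M ] (Popular G PH M × T (InM M x y))))
    ×
    ((∃[ M ] (Dominant G PA M × Dominant G PB M × T (InM M x y)))
       ⇔ (∃[ M ] (Dominant G PH M × T (InM M x y))))
corollary1 G PA PB PH x y validA validB differ xy (_ , keep , raise , lower) =
  mk⇔ (λ (M , popA , popB , xy∈M) →
         M , Equivalence.from (popular-hybrid (proj₁ popA) xy∈M) (popA , popB) , xy∈M)
      (λ (M , popH , xy∈M) →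
         let (popA , popB) = Equivalence.to (popular-hybrid (proj₁ popH) xy∈M) popH
         in M , popA , popB , xy∈M)
  , mk⇔ (λ (M , domA , domB , xy∈M) →
           M , Equivalence.from (dominant-hybrid (proj₁ (proj₁ domA)) xy∈M) (domA , domB) , xy∈M)
        (λ (M , domH , xy∈M) →
           let (domA , domB) = Equivalence.to (dominant-hybrid (proj₁ (proj₁ domH)) xy∈M) domH
           in M , domA , domB , xy∈M)
  where open Hybrid G PA PB PH x y validA validB differ xy keep raise lower
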